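{- Let $\alpha\le 2$ and $1\le\beta\le4$ be integers, and let $A,B,C,D$ be odd integers with $\gcd(A,C)=\gcd(B,D)=1$. Let $N$ be an integer with $1\le N\le15$. Suppose one of the following holds: (i) $\alpha\le0$ and $\beta\in\{3,4\}$; (ii) $(\alpha,\beta)\in\{1\}\times\{1,2,4\}\cup\{2\}\times\{1,2,3\}$; (iii) $(\alpha,\beta)=(2,4)$ and $AD\not\equiv BC\pmod 4$. Then there are no rational numbers $x_1,\dots,x_N$ satisfying simultaneously $$x_1^2+\dots+x_N^2=\frac{A}{2^{\alpha}C}\qquad\text{and}\qquad x_1^4+\dots+x_N^4=\frac{B}{2^{\beta}D}.$$ -}

module Defs where

open import Data.Nat as ℕ using (ℕ; zero; suc)
open import Data.Nat.Properties using (m^n≢0)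
open import Data.Integer as ℤ using (ℤ; +_; -[1+_])
open import Data.Integer.Divisibility using (_∣_)
open import Data.Fin using (Fin)
open import Data.Rational using (ℚ; 0ℚ; _/_; _+_; _*_)
open import Relation.Nullary using (¬_)

Odd : ℤ → Set
Odd a = ¬ (+ 2 ∣ a)

ι : ℤ → ℚ
ι a = a / 1

two^ : ℤ → ℚ
two^ (+ n) = + (2 ℕ.^ n) / 1
two^ -[1+ n ] = _/_ (+ 1) (2 ℕ.^ suc n) {{m^n≢0 2 (suc n)}}

sumℚ : ∀ {n} → (Fin n → ℚ) → ℚ
sumℚ {zero} x = 0ℚ
sumℚ {suc n} x = x Fin.zero + sumℚ (λ i → x (Fin.suc i))
  where import Data.Fin as Fin

_^ℚ_ : ℚ → ℕ → ℚ
q ^ℚ zero = + 1 / 1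
q ^ℚ suc k = q * (q ^ℚ k)

-- Write x = a / M with M = 2^e m, m odd, where e = 0 or some a_i is odd.  Since odd squares
-- are 1 modulo 8, Σ a_i² ≡ K (mod 4) and Σ a_i⁴ ≡ K (mod 16) for K the number of odd a_i.
-- If e = 0, the quartic equation has an even left and an odd right side.  Otherwise
-- 1 ≤ K ≤ 15, so ν₂(K) = k ≤ 3, and comparing 2-adic valuations in the quartic equation gives
-- β + k = 4e; as 1 ≤ β ≤ 4 this forces e = 1 and β = 4 - k.  The quadratic equation then gives
-- α = 2, α = 1 or α ≤ 0 according as k = 0, k = 1 or k ≥ 2, and when (α, β) = (2, 4) reducing
-- both equations modulo 4 gives AD ≡ BC.
module Submission where

open import Defs
open import Data.Nat as ℕ using (ℕ; zero; suc; z≤n; s≤s)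
import Data.Nat.Properties as ℕ
open import Data.Integer as ℤ using (ℤ; +_; -[1+_]; 0ℤ; ∣_∣)
import Data.Integer.Properties as ℤ
open import Data.Integer.Divisibility using (_∣_)
open import Algebra.Properties.Monoid.Sum ℤ.+-0-monoid using (sum-syntax)
open import Data.Fin using (Fin; zero; suc)
open import Data.Product using (∃; ∃₂; _×_; _,_; proj₁; proj₂)
open import Data.Sum using (_⊎_; inj₁; inj₂; [_,_]′)
open import Data.Empty using (⊥-elim)
open import Function using (_∘_)
open import Relation.Nullary using (¬_)
open import Relation.Binary.PropositionalEquality
  using (_≡_; _≢_; refl; sym; trans; cong; cong₂; subst; subst₂; module ≡-Reasoning)

module Parity where

  import Data.Nat.Divisibility as ℕ
  open import Data.Nat.Primality using (euclidsLemma; prime[2])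
  open import Data.Integer using (_+_; _*_; _^_)
  open import Data.Integer.DivMod using (_%ℕ_; _/ℕ_; n%ℕd<d; a≡a%ℕn+[a/ℕn]*n)
  open import Data.Integer.Divisibility.Signed using (divides; ∣ᵤ⇒∣; ∣⇒∣ᵤ; ∣m+n∣n⇒∣m)
  open import Data.Integer.Solver using (module +-*-Solver)
  open +-*-Solver

  data Parity : ℤ → Set where
    even : ∀ t → Parity (+ 2 * t)
    odd  : ∀ t → Parity (+ 1 + + 2 * t)

  parity : ∀ x → Parity x
  parity x with x %ℕ 2 | n%ℕd<d x 2 | a≡a%ℕn+[a/ℕn]*n x 2
  ... | 0           | _            | x≡ =
    subst Parity (sym (trans x≡ (trans (ℤ.+-identityˡ _) (ℤ.*-comm (x /ℕ 2) (+ 2))))) (even (x /ℕ 2))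
  ... | 1           | _            | x≡ =
    subst Parity (sym (trans x≡ (cong (_+_ (+ 1)) (ℤ.*-comm (x /ℕ 2) (+ 2))))) (odd (x /ℕ 2))
  ... | suc (suc _) | s≤s (s≤s ()) | _

  2∣2* : ∀ t → + 2 ∣ + 2 * t
  2∣2* t = ∣⇒∣ᵤ {+ 2} {+ 2 * t} (divides t (ℤ.*-comm (+ 2) t))

  odd-1 : Odd (+ 1)
  odd-1 2∣1 with ℕ.∣1⇒≡1 2∣1
  ... | ()

  odd-+-even : ∀ {x} → Odd x → ∀ y → Odd (x + + 2 * y)
  odd-+-even {x} ox y 2∣x+2y =
    ox (∣⇒∣ᵤ {+ 2} {x} (∣m+n∣n⇒∣m {n = + 2 * y} (∣ᵤ⇒∣ 2∣x+2y) (∣ᵤ⇒∣ (2∣2* y))))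

  odd-1+2* : ∀ t → Odd (+ 1 + + 2 * t)
  odd-1+2* = odd-+-even {+ 1} odd-1

  odd-* : ∀ {x y} → Odd x → Odd y → Odd (x * y)
  odd-* {x} {y} ox oy 2∣xy =
    [ ox , oy ]′ (euclidsLemma ∣ x ∣ ∣ y ∣ prime[2] (subst (2 ℕ.∣_) (ℤ.abs-* x y) 2∣xy))

  odd⇒≢0 : ∀ {x} → Odd x → x ≢ 0ℤ
  odd⇒≢0 ox refl = ox (2 ℕ.∣0)

  odd⇒1+2* : ∀ {x} → Odd x → ∃ λ t → x ≡ + 1 + + 2 * t
  odd⇒1+2* {x} ox with parity x
  ... | even t = ⊥-elim (ox (2∣2* t))
  ... | odd t  = t , refl

  even-or-odd : ∀ x → (∃ λ t → x ≡ + 2 * t) ⊎ Odd x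
  even-or-odd x with parity x
  ... | even t = inj₁ (t , refl)
  ... | odd t  = inj₂ (odd-1+2* t)

  odd-square : ∀ {x} → Odd x → ∃ λ s → x ^ 2 ≡ + 1 + + 8 * s
  odd-square {x} ox with odd⇒1+2* {x} ox
  ... | t , refl with parity t
  ...   | even u = u + + 2 * u * u ,
    solve 1 (λ u → (con (+ 1) :+ con (+ 2) :* (con (+ 2) :* u)) :^ 2
                   := con (+ 1) :+ con (+ 8) :* (u :+ con (+ 2) :* u :* u)) refl u
  ...   | odd u  = + 1 + + 3 * u + + 2 * u * u ,
    solve 1 (λ u → (con (+ 1) :+ con (+ 2) :* (con (+ 1) :+ con (+ 2) :* u)) :^ 2
                   := con (+ 1) :+ con (+ 8) :* (con (+ 1) :+ con (+ 3) :* u :+ con (+ 2) :* u :* u)) refl u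

open Parity

module TwoAdicValuation where

  open import Data.Nat using (_≤_; _<_; _∸_)
  open import Data.Integer using (_+_; _*_; _^_)
  open import Data.Integer.Solver using (module +-*-Solver)
  open import Algebra.Properties.CommutativeSemigroup ℤ.*-commutativeSemigroup using (interchange)
  open import Data.Product using (map)
  open +-*-Solver

  infix 8 2^_
  2^_ : ℕ → ℤ
  2^ k = (+ 2) ^ k

  2^-pos : ∀ k → 2^ k ≡ + (2 ℕ.^ k)
  2^-pos zero    = refl
  2^-pos (suc k) = trans (cong (+ 2 *_) (2^-pos k)) (sym (ℤ.pos-* 2 (2 ℕ.^ k)))

  2^-cancelˡ : ∀ n {x y} → 2^ n * x ≡ 2^ n * y → x ≡ y
  2^-cancelˡ n {x} {y} = ℤ.*-cancelˡ-≡ (2^ n) x y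
    where
    2≢0 : + 2 ≢ 0ℤ
    2≢0 ()
    instance
      2^n-nonZero : ℤ.NonZero (2^ n)
      2^n-nonZero = ℤ.≢-nonZero (2≢0 ∘ ℤ.i^n≡0⇒i≡0 (+ 2) n)

  record Val₂ (k : ℕ) (x : ℤ) : Set where
    constructor val₂
    field
      oddPart     : ℤ
      oddPart-odd : Odd oddPart
      decomposes  : x ≡ 2^ k * oddPart

  val₂-odd : ∀ {u} → Odd u → Val₂ 0 u
  val₂-odd {u} ou = val₂ u ou (sym (ℤ.*-identityˡ u))

  val₂-2^ : ∀ k → Val₂ k (2^ k)
  val₂-2^ k = val₂ (+ 1) odd-1 (sym (ℤ.*-identityʳ (2^ k)))

  val₂-* : ∀ {i j x y} → Val₂ i x → Val₂ j y → Val₂ (i ℕ.+ j) (x * y)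
  val₂-* {i} {j} (val₂ u ou refl) (val₂ w ow refl) = val₂ (u * w) (odd-* {u} {w} ou ow) (begin
    2^ i * u * (2^ j * w)     ≡⟨ interchange (2^ i) u (2^ j) w ⟩
    2^ i * 2^ j * (u * w)     ≡⟨ cong (_* (u * w)) (ℤ.^-distribˡ-+-* (+ 2) i j) ⟨
    2^ (i ℕ.+ j) * (u * w)    ∎)
    where open ≡-Reasoning

  val₂-^ : ∀ {k x} → Val₂ k x → ∀ n → Val₂ (n ℕ.* k) (x ^ n)
  val₂-^ v zero    = val₂ (+ 1) odd-1 refl
  val₂-^ v (suc n) = val₂-* v (val₂-^ v n)

  val₂-halve : ∀ {k x} → Val₂ (suc k) (+ 2 * x) → Val₂ k x
  val₂-halve {k} {x} (val₂ u ou 2x≡) =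
    val₂ u ou (ℤ.*-cancelˡ-≡ (+ 2) x _ (trans 2x≡ (ℤ.*-assoc (+ 2) (2^ k) u)))

  val₂-≤ : ∀ {k} j {y} → Val₂ k (2^ j * y) → j ≤ k
  val₂-≤ zero _ = z≤n
  val₂-≤ {zero} (suc j) {y} (val₂ u ou 2^[1+j]y≡u) = ⊥-elim (ou (subst (+ 2 ∣_) (begin
    + 2 * (2^ j * y)   ≡⟨ ℤ.*-assoc (+ 2) (2^ j) y ⟨
    2^ suc j * y       ≡⟨ 2^[1+j]y≡u ⟩
    + 1 * u            ≡⟨ ℤ.*-identityˡ u ⟩
    u                  ∎) (2∣2* (2^ j * y))))
    where open ≡-Reasoning
  val₂-≤ {suc k} (suc j) {y} v =
    s≤s (val₂-≤ j (val₂-halve (subst (Val₂ (suc k)) (ℤ.*-assoc (+ 2) (2^ j) y) v)))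

  val₂-unique : ∀ {i j x} → Val₂ i x → Val₂ j x → i ≡ j
  val₂-unique {i} {j} vi@(val₂ _ _ x≡2^i*u) vj@(val₂ _ _ x≡2^j*w) =
    ℕ.≤-antisym (val₂-≤ i (subst (Val₂ j) x≡2^i*u vj)) (val₂-≤ j (subst (Val₂ i) x≡2^j*w vi))

  val₂-+ : ∀ {k j x} → Val₂ k x → k < j → ∀ y → Val₂ k (x + 2^ j * y)
  val₂-+ {k} {j} (val₂ u ou refl) k<j y = val₂ (u + + 2 * (2^ d * y)) (odd-+-even {u} ou _) (begin
    2^ k * u + 2^ j * y                    ≡⟨ cong (λ n → 2^ k * u + 2^ n * y) j≡ ⟨
    2^ k * u + 2^ (k ℕ.+ suc d) * y        ≡⟨ cong (λ z → 2^ k * u + z * y) (ℤ.^-distribˡ-+-* (+ 2) k (suc d)) ⟩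
    2^ k * u + 2^ k * (+ 2 * 2^ d) * y     ≡⟨ solve 4 (λ t u s y → t :* u :+ t :* (con (+ 2) :* s) :* y
                                                            := t :* (u :+ con (+ 2) :* (s :* y)))
                                                   refl (2^ k) u (2^ d) y ⟩
    2^ k * (u + + 2 * (2^ d * y))          ∎)
    where
    open ≡-Reasoning
    d : ℕ
    d = j ∸ suc k
    j≡ : k ℕ.+ suc d ≡ j
    j≡ = trans (ℕ.+-suc k d) (ℕ.m+[n∸m]≡n k<j)

  val₂-< : ∀ {k j x} → Val₂ k x → ∣ x ∣ < 2 ℕ.^ j → k < j
  val₂-< {k} {j} (val₂ u ou refl) ∣x∣<2^j = ℕ.≰⇒> λ j≤k → ℕ.<⇒≱ ∣x∣<2^j (begin
    2 ℕ.^ j            ≤⟨ ℕ.^-monoʳ-≤ 2 j≤k ⟩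
    2 ℕ.^ k            ≤⟨ ℕ.m≤m*n (2 ℕ.^ k) ∣ u ∣ ⟩
    2 ℕ.^ k ℕ.* ∣ u ∣  ≡⟨ cong (λ z → ∣ z ∣ ℕ.* ∣ u ∣) (2^-pos k) ⟨
    ∣ 2^ k ∣ ℕ.* ∣ u ∣ ≡⟨ ℤ.abs-* (2^ k) u ⟨
    ∣ 2^ k * u ∣       ∎)
    where
    open ℕ.≤-Reasoning
    instance
      ∣u∣-nonZero : ℕ.NonZero ∣ u ∣
      ∣u∣-nonZero = ℕ.≢-nonZero (odd⇒≢0 {u} ou ∘ ℤ.∣i∣≡0⇒i≡0)

  val₂-exists : ∀ {x} → x ≢ 0ℤ → ∃ λ k → Val₂ k x
  val₂-exists {x} = bounded (suc ∣ x ∣) ℕ.≤-refl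
    where
    bounded : ∀ n {x} → ∣ x ∣ < n → x ≢ 0ℤ → ∃ λ k → Val₂ k x
    bounded (suc n) {x} ∣x∣<1+n x≢0 with parity x
    ... | odd t  = 0 , val₂-odd {+ 1 + + 2 * t} (odd-1+2* t)
    ... | even t = map suc (val₂-* (val₂-2^ 1)) (bounded n (ℕ.<-≤-trans ∣t∣<∣2t∣ (ℕ.s≤s⁻¹ ∣x∣<1+n)) t≢0)
      where
      t≢0 : t ≢ 0ℤ
      t≢0 refl = x≢0 refl
      instance
        ∣t∣-nonZero : ℕ.NonZero ∣ t ∣
        ∣t∣-nonZero = ℕ.≢-nonZero (t≢0 ∘ ℤ.∣i∣≡0⇒i≡0)
      ∣t∣<∣2t∣ : ∣ t ∣ < ∣ + 2 * t ∣
      ∣t∣<∣2t∣ = subst (∣ t ∣ <_) (trans (ℕ.*-comm ∣ t ∣ 2) (sym (ℤ.abs-* (+ 2) t)))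
                       (ℕ.m<m*n ∣ t ∣ 2 (s≤s (s≤s z≤n)))

open TwoAdicValuation

module OddCount where

  open import Data.Nat using (_≤_; _<_)
  open import Data.Integer using (_+_; _*_; _^_)
  open import Data.Integer.Solver using (module +-*-Solver)
  open +-*-Solver

  oddity : ∀ {x} → Parity x → ℕ
  oddity (even _) = 0
  oddity (odd _)  = 1

  oddity≤1 : ∀ {x} (p : Parity x) → oddity p ≤ 1
  oddity≤1 (even _) = z≤n
  oddity≤1 (odd _)  = s≤s z≤n

  oddity-odd : ∀ {x} → Odd x → (p : Parity x) → oddity p ≡ 1
  oddity-odd ox (even t) = ⊥-elim (ox (2∣2* t))
  oddity-odd ox (odd t)  = refl

  square-residue : ∀ {x} (p : Parity x) → ∃ λ r → x ^ 2 ≡ + oddity p + + 4 * r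
  square-residue (even t) = t ^ 2 ,
    solve 1 (λ t → (con (+ 2) :* t) :^ 2 := con (+ 0) :+ con (+ 4) :* t :^ 2) refl t
  square-residue (odd t) with odd-square {+ 1 + + 2 * t} (odd-1+2* t)
  ... | s , sq≡ = + 2 * s ,
    trans sq≡ (solve 1 (λ s → con (+ 1) :+ con (+ 8) :* s := con (+ 1) :+ con (+ 4) :* (con (+ 2) :* s))
                       refl s)

  fourth-residue : ∀ {x} (p : Parity x) → ∃ λ r → x ^ 4 ≡ + oddity p + + 16 * r
  fourth-residue (even t) = t ^ 4 ,
    solve 1 (λ t → (con (+ 2) :* t) :^ 4 := con (+ 0) :+ con (+ 16) :* t :^ 4) refl t
  fourth-residue (odd t) with odd-square {+ 1 + + 2 * t} (odd-1+2* t)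
  ... | s , sq≡ = s + + 4 * s * s , (begin
    x ^ 4                           ≡⟨ ℤ.^-*-assoc x 2 2 ⟨
    (x ^ 2) ^ 2                     ≡⟨ cong (_^ 2) sq≡ ⟩
    (+ 1 + + 8 * s) ^ 2             ≡⟨ solve 1 (λ s → (con (+ 1) :+ con (+ 8) :* s) :^ 2
                                                  := con (+ 1) :+ con (+ 16) :* (s :+ con (+ 4) :* s :* s)) refl s ⟩
    + 1 + + 16 * (s + + 4 * s * s)  ∎)
    where
    open ≡-Reasoning
    x : ℤ
    x = + 1 + + 2 * t

  oddCount : ∀ {N} → (Fin N → ℤ) → ℕ
  oddCount {zero}  a = 0
  oddCount {suc N} a = oddity (parity (a zero)) ℕ.+ oddCount (a ∘ suc)

  oddCount≤ : ∀ {N} (a : Fin N → ℤ) → oddCount a ≤ N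
  oddCount≤ {zero}  a = z≤n
  oddCount≤ {suc N} a = ℕ.+-mono-≤ (oddity≤1 (parity (a zero))) (oddCount≤ (a ∘ suc))

  oddCount-pos : ∀ {N} (a : Fin N → ℤ) i → Odd (a i) → 0 < oddCount a
  oddCount-pos a zero    odd-aᵢ rewrite oddity-odd odd-aᵢ (parity (a zero)) = s≤s z≤n
  oddCount-pos a (suc i) odd-aᵢ =
    ℕ.<-≤-trans (oddCount-pos (a ∘ suc) i odd-aᵢ) (ℕ.m≤n+m _ (oddity (parity (a zero))))

  ∑-residue : ∀ n (f : ℤ → ℤ) → (∀ {x} (p : Parity x) → ∃ λ r → f x ≡ + oddity p + + n * r) →
              ∀ {N} (a : Fin N → ℤ) → ∃ λ R → ∑[ i < N ] f (a i) ≡ + oddCount a + + n * R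
  ∑-residue n f residue {zero}  a = 0ℤ , sym (trans (ℤ.+-identityˡ _) (ℤ.*-zeroʳ (+ n)))
  ∑-residue n f residue {suc N} a with residue (parity (a zero)) | ∑-residue n f residue (a ∘ suc)
  ... | r , head≡ | R , tail≡ = r + R , (begin
    f (a zero) + ∑[ i < N ] f (a (suc i))   ≡⟨ cong₂ _+_ head≡ tail≡ ⟩
    + χ + + n * r + (+ K + + n * R)         ≡⟨ solve 5 (λ χ K n r R → χ :+ n :* r :+ (K :+ n :* R)
                                                                  := χ :+ K :+ n :* (r :+ R))
                                                   refl (+ χ) (+ K) (+ n) r R ⟩
    + χ + + K + + n * (r + R)               ≡⟨ cong (_+ + n * (r + R)) (ℤ.pos-+ χ K) ⟨
    + (χ ℕ.+ K) + + n * (r + R)             ∎)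
    where
    open ≡-Reasoning
    χ K : ℕ
    χ = oddity (parity (a zero))
    K = oddCount (a ∘ suc)

open OddCount

module Embedding where

  open import Data.Rational using (ℚ; 1ℚ; _+_; _*_; toℚᵘ; fromℚᵘ; NonZero; 1/_)
  import Data.Rational.Properties as ℚ
  open import Data.Rational.Unnormalised as ℚᵘ using (mkℚᵘ; *≡*)
  import Data.Rational.Unnormalised.Properties as ℚᵘ

  fromℚᵘ-homo-* : ∀ p q → fromℚᵘ (p ℚᵘ.* q) ≡ fromℚᵘ p * fromℚᵘ q
  fromℚᵘ-homo-* p q = ℚ.toℚᵘ-injective (begin
    toℚᵘ (fromℚᵘ (p ℚᵘ.* q))               ≈⟨ ℚ.toℚᵘ-fromℚᵘ (p ℚᵘ.* q) ⟩
    p ℚᵘ.* q                               ≈⟨ ℚᵘ.*-cong (ℚ.toℚᵘ-fromℚᵘ p) (ℚ.toℚᵘ-fromℚᵘ q) ⟨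
    toℚᵘ (fromℚᵘ p) ℚᵘ.* toℚᵘ (fromℚᵘ q)   ≈⟨ ℚ.toℚᵘ-homo-* (fromℚᵘ p) (fromℚᵘ q) ⟨
    toℚᵘ (fromℚᵘ p * fromℚᵘ q)             ∎)
    where open ℚᵘ.≃-Reasoning

  fromℚᵘ-homo-+ : ∀ p q → fromℚᵘ (p ℚᵘ.+ q) ≡ fromℚᵘ p + fromℚᵘ q
  fromℚᵘ-homo-+ p q = ℚ.toℚᵘ-injective (begin
    toℚᵘ (fromℚᵘ (p ℚᵘ.+ q))               ≈⟨ ℚ.toℚᵘ-fromℚᵘ (p ℚᵘ.+ q) ⟩
    p ℚᵘ.+ q                               ≈⟨ ℚᵘ.+-cong (ℚ.toℚᵘ-fromℚᵘ p) (ℚ.toℚᵘ-fromℚᵘ q) ⟨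
    toℚᵘ (fromℚᵘ p) ℚᵘ.+ toℚᵘ (fromℚᵘ q)   ≈⟨ ℚ.toℚᵘ-homo-+ (fromℚᵘ p) (fromℚᵘ q) ⟨
    toℚᵘ (fromℚᵘ p + fromℚᵘ q)             ∎)
    where open ℚᵘ.≃-Reasoning

  -- ι a is definitionally fromℚᵘ (mkℚᵘ a 0).
  ι-* : ∀ a b → ι (a ℤ.* b) ≡ ι a * ι b
  ι-* a b = fromℚᵘ-homo-* (mkℚᵘ a 0) (mkℚᵘ b 0)

  ι-+ : ∀ a b → ι (a ℤ.+ b) ≡ ι a + ι b
  ι-+ a b = trans
    (ℚ.fromℚᵘ-cong {mkℚᵘ (a ℤ.+ b) 0} {mkℚᵘ a 0 ℚᵘ.+ mkℚᵘ b 0}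
      (*≡* (cong (ℤ._* + 1) (cong₂ ℤ._+_ (sym (ℤ.*-identityʳ a)) (sym (ℤ.*-identityʳ b))))))
    (fromℚᵘ-homo-+ (mkℚᵘ a 0) (mkℚᵘ b 0))

  ι-injective : ∀ {a b} → ι a ≡ ι b → a ≡ b
  ι-injective {a} {b} ιa≡ιb with ℚ.fromℚᵘ-injective {mkℚᵘ a 0} {mkℚᵘ b 0} ιa≡ιb
  ... | *≡* a*1≡b*1 = trans (sym (ℤ.*-identityʳ a)) (trans a*1≡b*1 (ℤ.*-identityʳ b))

  ι-∑ : ∀ {N} (a : Fin N → ℤ) → sumℚ (ι ∘ a) ≡ ι (∑[ i < N ] a i)
  ι-∑ {zero}  a = refl
  ι-∑ {suc N} a = trans (cong (_+_ (ι (a zero))) (ι-∑ (a ∘ suc))) (sym (ι-+ (a zero) _))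

  sumℚ-*-distribʳ : ∀ {N} (f : Fin N → ℚ) c → sumℚ f * c ≡ sumℚ (λ i → f i * c)
  sumℚ-*-distribʳ {zero}  f c = ℚ.*-zeroˡ c
  sumℚ-*-distribʳ {suc N} f c =
    trans (ℚ.*-distribʳ-+ c (f zero) _) (cong (_+_ (f zero * c)) (sumℚ-*-distribʳ (f ∘ suc) c))

  sumℚ-cong : ∀ {N} {f g : Fin N → ℚ} → (∀ i → f i ≡ g i) → sumℚ f ≡ sumℚ g
  sumℚ-cong {zero}  f≗g = refl
  sumℚ-cong {suc N} f≗g = cong₂ _+_ (f≗g zero) (sumℚ-cong (f≗g ∘ suc))

  *-cancelˡ-≡ : ∀ r {p q} .{{_ : NonZero r}} → r * p ≡ r * q → p ≡ q
  *-cancelˡ-≡ r {p} {q} rp≡rq = begin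
    p                  ≡⟨ ℚ.*-identityˡ p ⟨
    1ℚ * p             ≡⟨ cong (_* p) (ℚ.*-inverseˡ r) ⟨
    1/ r * r * p       ≡⟨ ℚ.*-assoc (1/ r) r p ⟩
    1/ r * (r * p)     ≡⟨ cong (1/ r *_) rp≡rq ⟩
    1/ r * (r * q)     ≡⟨ ℚ.*-assoc (1/ r) r q ⟨
    1/ r * r * q       ≡⟨ cong (_* q) (ℚ.*-inverseˡ r) ⟩
    1ℚ * q             ≡⟨ ℚ.*-identityˡ q ⟩
    q                  ∎
    where open ≡-Reasoning

open Embedding

module ClearingDenominators where

  open import Data.Rational as ℚ using (ℚ; mkℚ; 1ℚ; _*_; fromℚᵘ; ↥_; ↧_)
  import Data.Rational.Properties as ℚ
  open import Data.Rational.Unnormalised as ℚᵘ using (mkℚᵘ; *≡*)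
  open import Data.Rational.Solver using (module +-*-Solver)
  open +-*-Solver

  infix 4 _≐_/_
  record _≐_/_ (x : ℚ) (a M : ℤ) : Set where
    constructor fraction
    field cleared : x * ι M ≡ ι a

  ↥/↧-fraction : ∀ x → x ≐ ↥ x / ↧ x
  ↥/↧-fraction x@(mkℚ n d _) = fraction (begin
    x * ι (↧ x)                               ≡⟨ cong (_* ι (↧ x)) (ℚ.fromℚᵘ-toℚᵘ x) ⟨
    fromℚᵘ (mkℚᵘ n d) * ι (+ suc d)           ≡⟨ fromℚᵘ-homo-* (mkℚᵘ n d) (mkℚᵘ (+ suc d) 0) ⟨
    fromℚᵘ (mkℚᵘ n d ℚᵘ.* mkℚᵘ (+ suc d) 0)   ≡⟨ ℚ.fromℚᵘ-cong {mkℚᵘ n d ℚᵘ.* mkℚᵘ (+ suc d) 0} {mkℚᵘ n 0}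
                                                   (*≡* (trans (ℤ.*-identityʳ _)
                                                     (cong (λ k → n ℤ.* + suc k) (sym (ℕ.*-identityʳ d))))) ⟩
    ι n                                       ∎)
    where open ≡-Reasoning

  1/d-fraction : ∀ d .{{_ : ℕ.NonZero d}} → + 1 ℚ./ d ≐ + 1 / + d
  1/d-fraction (suc d) = fraction (trans (sym (fromℚᵘ-homo-* (mkℚᵘ (+ 1) d) (mkℚᵘ (+ suc d) 0)))
    (ℚ.fromℚᵘ-cong {mkℚᵘ (+ 1) d ℚᵘ.* mkℚᵘ (+ suc d) 0} {mkℚᵘ (+ 1) 0}
      (*≡* (trans (ℤ.*-identityʳ _) (trans (ℤ.*-identityˡ _)
        (trans (cong (λ k → + suc k) (sym (ℕ.*-identityʳ d))) (sym (ℤ.*-identityˡ _))))))))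

  posPart negPart : ℤ → ℕ
  posPart (+ n)    = n
  posPart -[1+ n ] = 0
  negPart (+ n)    = 0
  negPart -[1+ n ] = suc n

  posPart≡negPart+⇒ : ∀ α {n} → posPart α ≡ negPart α ℕ.+ n → α ≡ + n
  posPart≡negPart+⇒ (+ m)    m≡n = cong +_ m≡n
  posPart≡negPart+⇒ -[1+ m ] ()

  posPart≤negPart⇒ : ∀ α → posPart α ℕ.≤ negPart α → α ℤ.≤ + 0
  posPart≤negPart⇒ (+ m)    m≤0 = ℤ.+≤+ m≤0
  posPart≤negPart⇒ -[1+ m ] _   = ℤ.-≤+

  two^-fraction : ∀ α → two^ α ≐ 2^ posPart α / 2^ negPart α
  two^-fraction (+ n)    = fraction (trans (ℚ.*-identityʳ _) (cong ι (sym (2^-pos n))))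
  two^-fraction -[1+ n ] = fraction (trans (cong (two^ -[1+ n ] *_) (cong ι (2^-pos (suc n))))
    (_≐_/_.cleared (1/d-fraction (2 ℕ.^ suc n) {{ℕ.m^n≢0 2 (suc n)}})))

  module _ {x : ℚ} {a M : ℤ} (x≐a/M : x ≐ a / M) where
    open ≡-Reasoning
    open _≐_/_ x≐a/M

    ≐-scale : ∀ L → x ≐ a ℤ.* L / M ℤ.* L
    ≐-scale L = fraction (begin
      x * ι (M ℤ.* L)     ≡⟨ cong (x *_) (ι-* M L) ⟩
      x * (ι M * ι L)     ≡⟨ ℚ.*-assoc x (ι M) (ι L) ⟨
      x * ι M * ι L       ≡⟨ cong (_* ι L) cleared ⟩
      ι a * ι L           ≡⟨ ι-* a L ⟨
      ι (a ℤ.* L)         ∎)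

    ≐-^ : ∀ k → x ^ℚ k ≐ a ℤ.^ k / M ℤ.^ k
    ≐-^ zero    = fraction (ℚ.*-identityˡ 1ℚ)
    ≐-^ (suc k) = fraction (begin
      x * x ^ℚ k * ι (M ℤ.* M ℤ.^ k)          ≡⟨ cong (x * x ^ℚ k *_) (ι-* M (M ℤ.^ k)) ⟩
      x * x ^ℚ k * (ι M * ι (M ℤ.^ k))        ≡⟨ solve 4 (λ x y m n → x :* y :* (m :* n) := x :* m :* (y :* n))
                                                     refl x (x ^ℚ k) (ι M) (ι (M ℤ.^ k)) ⟩
      x * ι M * (x ^ℚ k * ι (M ℤ.^ k))        ≡⟨ cong₂ _*_ cleared (_≐_/_.cleared (≐-^ k)) ⟩
      ι a * ι (a ℤ.^ k)                       ≡⟨ ι-* a (a ℤ.^ k) ⟨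
      ι (a ℤ.* a ℤ.^ k)                       ∎)

  ≐-halve : ∀ {x a M} → x ≐ + 2 ℤ.* a / + 2 ℤ.* M → x ≐ a / M
  ≐-halve {x} {a} {M} (fraction x*2M≡2a) = fraction (*-cancelˡ-≡ (ι (+ 2)) (begin
    ι (+ 2) * (x * ι M)     ≡⟨ solve 3 (λ t x m → t :* (x :* m) := x :* (t :* m)) refl (ι (+ 2)) x (ι M) ⟩
    x * (ι (+ 2) * ι M)     ≡⟨ cong (x *_) (ι-* (+ 2) M) ⟨
    x * ι (+ 2 ℤ.* M)       ≡⟨ x*2M≡2a ⟩
    ι (+ 2 ℤ.* a)           ≡⟨ ι-* (+ 2) a ⟩
    ι (+ 2) * ι a           ∎))
    where open ≡-Reasoning

  sumℚ-fraction : ∀ {N} {x : Fin N → ℚ} {a M} → (∀ i → x i ≐ a i / M) → sumℚ x ≐ ∑[ i < N ] a i / M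
  sumℚ-fraction {x = x} {a} {M} x≐a/M = fraction (trans (sumℚ-*-distribʳ x (ι M))
    (trans (sumℚ-cong (_≐_/_.cleared ∘ x≐a/M)) (ι-∑ a)))

  cross-multiply : ∀ {X T S m s t} C A → X ≐ S / m → T ≐ t / s → X * (T * ι C) ≡ ι A →
                   t ℤ.* (C ℤ.* S) ≡ s ℤ.* (A ℤ.* m)
  cross-multiply {X} {T} {S} {m} {s} {t} C A (fraction X*m≡S) (fraction T*s≡t) X*T*C≡A = ι-injective (begin
    ι (t ℤ.* (C ℤ.* S))          ≡⟨ trans (ι-* t _) (cong (ι t *_) (ι-* C S)) ⟩
    ι t * (ι C * ι S)            ≡⟨ cong₂ (λ u v → u * (ι C * v)) T*s≡t X*m≡S ⟨
    T * ι s * (ι C * (X * ι m))  ≡⟨ solve 5 (λ T s C X m → T :* s :* (C :* (X :* m))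
                                                        := s :* (X :* (T :* C) :* m))
                                      refl T (ι s) (ι C) X (ι m) ⟩
    ι s * (X * (T * ι C) * ι m)  ≡⟨ cong (λ u → ι s * (u * ι m)) X*T*C≡A ⟩
    ι s * (ι A * ι m)            ≡⟨ trans (ι-* s _) (cong (ι s *_) (ι-* A m)) ⟨
    ι (s ℤ.* (A ℤ.* m))          ∎)
    where open ≡-Reasoning

  common-denominator : ∀ {N} (x : Fin N → ℚ) → ∃₂ λ M (a : Fin N → ℤ) → M ≢ 0ℤ × (∀ i → x i ≐ a i / M)
  common-denominator {zero}  x = + 1 , (λ ()) , (λ ()) , (λ ())
  common-denominator {suc N} x with common-denominator (x ∘ suc)
  ... | M , a , M≢0 , x≐a/M = ↧ x₀ ℤ.* M , a′ , dM≢0 , x≐a′/dM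
    where
    x₀ : ℚ
    x₀ = x zero
    a′ : Fin (suc N) → ℤ
    a′ zero    = ↥ x₀ ℤ.* M
    a′ (suc i) = a i ℤ.* ↧ x₀
    dM≢0 : ↧ x₀ ℤ.* M ≢ 0ℤ
    dM≢0 dM≡0 with ℤ.i*j≡0⇒i≡0∨j≡0 (↧ x₀) dM≡0 | x₀
    ... | inj₂ M≡0 | _         = M≢0 M≡0
    ... | inj₁ ()  | mkℚ _ _ _
    x≐a′/dM : ∀ i → x i ≐ a′ i / ↧ x₀ ℤ.* M
    x≐a′/dM zero    = ≐-scale (↥/↧-fraction x₀) M
    x≐a′/dM (suc i) = subst (x (suc i) ≐ a′ (suc i) /_) (ℤ.*-comm M (↧ x₀)) (≐-scale (x≐a/M i) (↧ x₀))

  halves-or-odd-entry : ∀ {N} (a : Fin N → ℤ) →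
                        (∃ λ (b : Fin N → ℤ) → ∀ i → a i ≡ + 2 ℤ.* b i) ⊎ (∃ λ i → Odd (a i))
  halves-or-odd-entry {zero}  a = inj₁ ((λ ()) , (λ ()))
  halves-or-odd-entry {suc N} a with even-or-odd (a zero) | halves-or-odd-entry (a ∘ suc)
  ... | inj₂ odd₀       | _               = inj₂ (zero , odd₀)
  ... | inj₁ _          | inj₂ (i , oddᵢ) = inj₂ (suc i , oddᵢ)
  ... | inj₁ (t , a₀≡) | inj₁ (b , aₛ≡)  = inj₁ (b′ , a≡)
    where
    b′ : Fin (suc N) → ℤ
    b′ zero    = t
    b′ (suc i) = b i
    a≡ : ∀ i → a i ≡ + 2 ℤ.* b′ i
    a≡ zero    = a₀≡
    a≡ (suc i) = aₛ≡ i

  record ReducedFractions {N} (x : Fin N → ℚ) : Set where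
    field
      e       : ℕ
      M       : ℤ
      a       : Fin N → ℤ
      ν₂M     : Val₂ e M
      x≐a/M   : ∀ i → x i ≐ a i / M
      reduced : e ≡ 0 ⊎ ∃ λ i → Odd (a i)

  reduce : ∀ {N} {x : Fin N → ℚ} e {M a} → Val₂ e M → (∀ i → x i ≐ a i / M) → ReducedFractions x
  reduce zero {a = a} ν₂M x≐a/M = record { a = a ; ν₂M = ν₂M ; x≐a/M = x≐a/M ; reduced = inj₁ refl }
  reduce {x = x} (suc e) {a = a} ν₂M@(val₂ m om refl) x≐a/M with halves-or-odd-entry a
  ... | inj₂ odd-entry  = record { a = a ; ν₂M = ν₂M ; x≐a/M = x≐a/M ; reduced = inj₂ odd-entry }
  ... | inj₁ (b , a≡2b) = reduce e {a = b} (val₂ m om refl) λ i →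
    ≐-halve (subst₂ (λ aᵢ M → x i ≐ aᵢ / M) (a≡2b i) (ℤ.*-assoc (+ 2) (2^ e) m) (x≐a/M i))

  reduceFractions : ∀ {N} (x : Fin N → ℚ) → ReducedFractions x
  reduceFractions x with common-denominator x
  ... | M , a , M≢0 , x≐a/M with val₂-exists M≢0
  ...   | e , ν₂M = reduce e ν₂M x≐a/M

  power-sum-fraction : ∀ {N} {x : Fin N → ℚ} {a : Fin N → ℤ} {M} → (∀ i → x i ≐ a i / M) →
                       ∀ k → sumℚ (λ i → x i ^ℚ k) ≐ ∑[ i < N ] (a i ℤ.^ k) / M ℤ.^ k
  power-sum-fraction x≐a/M k = sumℚ-fraction (λ i → ≐-^ (x≐a/M i) k)

open ClearingDenominators

module ExponentBounds where

  open import Data.Nat using (_≤_; _<_)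
  open import Data.Integer using (_+_; _-_; _*_; _^_)
  open import Data.Integer.Divisibility.Signed using (divides; ∣⇒∣ᵤ)
  open import Data.Integer.Solver using (module +-*-Solver)

  -- m² ≡ m⁴ ≡ 1 (mod 4), so A ≡ CK and B ≡ DK (mod 4).
  4∣AD-BC : ∀ {A B C D m K P Q} → Odd m → C * (K + + 4 * P) ≡ A * m ^ 2 → D * (K + + 16 * Q) ≡ B * m ^ 4 →
            + 4 ∣ A * D - B * C
  4∣AD-BC {A} {B} {C} {D} {m} {K} {P} {Q} om hC hD with odd⇒1+2* {m} om
  ... | t , refl = ∣⇒∣ᵤ {+ 4} {A * D - B * C} (divides (C * D * (P - + 4 * Q) + E) (begin
    A * D - B * C
      ≡⟨ solve 5 (λ A B C D t →
           let m = con (+ 1) :+ con (+ 2) :* t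
               u = t :+ t :* t
           in A :* D :- B :* C
              := D :* (A :* m :^ 2) :- C :* (B :* m :^ 4)
                 :+ con (+ 4) :* (B :* C :* (con (+ 2) :* u :+ con (+ 4) :* u :* u) :- A :* D :* u))
         refl A B C D t ⟩
    D * (A * m ^ 2) - C * (B * m ^ 4) + + 4 * E
      ≡⟨ cong₂ (λ x y → D * x - C * y + + 4 * E) hC hD ⟨
    D * (C * (K + + 4 * P)) - C * (D * (K + + 16 * Q)) + + 4 * E
      ≡⟨ solve 6 (λ C D K P Q E → D :* (C :* (K :+ con (+ 4) :* P)) :- C :* (D :* (K :+ con (+ 16) :* Q))
                                   :+ con (+ 4) :* E
                                 := (C :* D :* (P :- con (+ 4) :* Q) :+ E) :* con (+ 4))
         refl C D K P Q E ⟩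
    (C * D * (P - + 4 * Q) + E) * + 4
      ∎))
    where
    open ≡-Reasoning
    open +-*-Solver
    u E : ℤ
    u = t + t * t
    E = B * C * (+ 2 * u + + 4 * u * u) - A * D * u

  ≡4*e⇒e≡1 : ∀ {b k e} → 1 ≤ b → b ≤ 4 → k < 4 → b ℕ.+ k ≡ 4 ℕ.* e → e ≡ 1
  ≡4*e⇒e≡1 {b} {k} {zero}        1≤b _ _ b+k≡0 = ⊥-elim (ℕ.<⇒≢ 1≤b (sym (ℕ.m+n≡0⇒m≡0 b b+k≡0)))
  ≡4*e⇒e≡1 {e = suc zero}          _ _ _ _ = refl
  ≡4*e⇒e≡1 {b} {k} {suc (suc e)} _ b≤4 k<4 b+k≡4e = ⊥-elim (ℕ.<⇒≱ (ℕ.+-mono-≤-< b≤4 k<4) (begin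
    8                     ≤⟨ ℕ.*-monoʳ-≤ 4 (s≤s (s≤s z≤n)) ⟩
    4 ℕ.* suc (suc e)     ≡⟨ b+k≡4e ⟨
    b ℕ.+ k               ∎))
    where open ℕ.≤-Reasoning

  data PossibleExponents (A B C D α β : ℤ) : Set where
    two-four    : α ≡ + 2 → β ≡ + 4 → + 4 ∣ A * D - B * C → PossibleExponents A B C D α β
    one-three   : α ≡ + 1 → β ≡ + 3 → PossibleExponents A B C D α β
    nonpositive : α ℤ.≤ + 0 → β ℤ.≤ + 2 → PossibleExponents A B C D α β

  module ClearedEquations {N b : ℕ} (a : Fin N → ℤ) (M A B C D α : ℤ)
    (oA : Odd A) (oB : Odd B) (oC : Odd C) (oD : Odd D) (1≤b : 1 ≤ b) (b≤4 : b ≤ 4) (N≤15 : N ≤ 15)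
    (E2 : 2^ posPart α * (C * ∑[ i < N ] (a i ^ 2)) ≡ 2^ negPart α * (A * M ^ 2))
    (E4 : 2^ b * (D * ∑[ i < N ] (a i ^ 4)) ≡ B * M ^ 4) where

    open +-*-Solver

    p q : ℕ
    p = posPart α
    q = negPart α

    S₂ S₄ : ℤ
    S₂ = ∑[ i < N ] (a i ^ 2)
    S₄ = ∑[ i < N ] (a i ^ 4)
    K : ℕ
    K = oddCount a

    S₂-residue : ∃ λ P → S₂ ≡ + K + + 4 * P
    S₂-residue = ∑-residue 4 (_^ 2) square-residue a

    S₄-residue : ∃ λ Q → S₄ ≡ + K + + 16 * Q
    S₄-residue = ∑-residue 16 (_^ 4) fourth-residue a

    ν₂-S₄ : ∀ {k} → k < 4 → Val₂ k (+ K) → Val₂ k S₄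
    ν₂-S₄ k<4 ν₂K = subst (Val₂ _) (sym (proj₂ S₄-residue)) (val₂-+ ν₂K k<4 (proj₁ S₄-residue))

    ν₂-rhs₂ : ∀ {e} → Val₂ e M → Val₂ (q ℕ.+ 2 ℕ.* e) (2^ q * (A * M ^ 2))
    ν₂-rhs₂ ν₂M = val₂-* (val₂-2^ q) (val₂-* (val₂-odd {A} oA) (val₂-^ ν₂M 2))

    ν₂-lhs₂ : ∀ {j e} → Val₂ e M → Val₂ j S₂ → p ℕ.+ j ≡ q ℕ.+ 2 ℕ.* e
    ν₂-lhs₂ ν₂M ν₂S₂ =
      val₂-unique (val₂-* (val₂-2^ p) (val₂-* (val₂-odd {C} oC) ν₂S₂)) (subst (Val₂ _) (sym E2) (ν₂-rhs₂ ν₂M))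

    ν₂-rhs₄ : ∀ {e} → Val₂ e M → Val₂ (4 ℕ.* e) (B * M ^ 4)
    ν₂-rhs₄ ν₂M = val₂-* (val₂-odd {B} oB) (val₂-^ ν₂M 4)

    ν₂-lhs₄ : ∀ {k e} → Val₂ e M → Val₂ k S₄ → b ℕ.+ k ≡ 4 ℕ.* e
    ν₂-lhs₄ ν₂M ν₂S₄ =
      val₂-unique (val₂-* (val₂-2^ b) (val₂-* (val₂-odd {D} oD) ν₂S₄)) (subst (Val₂ _) (sym E4) (ν₂-rhs₄ ν₂M))

    odd-denominator-impossible : ¬ Val₂ 0 M
    odd-denominator-impossible ν₂M = ℕ.<⇒≱ 1≤b (val₂-≤ b (subst (Val₂ 0) (sym E4) (ν₂-rhs₄ ν₂M)))

    ν₂-oddCount : 0 < K → ∃ λ k → k < 4 × Val₂ k (+ K)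
    ν₂-oddCount 0<K with val₂-exists {+ K} (ℕ.<⇒≢ 0<K ∘ sym ∘ ℤ.+-injective)
    ... | k , ν₂K = k , val₂-< ν₂K (s≤s (ℕ.≤-trans (oddCount≤ a) N≤15)) , ν₂K

    case-ν₂K≡0 : Val₂ 0 (+ K) → b ≡ 4 → Val₂ 1 M → PossibleExponents A B C D α (+ b)
    case-ν₂K≡0 ν₂K b≡4 ν₂M@(val₂ m om M≡2m) =
      two-four (posPart≡negPart+⇒ α p≡q+2) (cong +_ b≡4)
               (4∣AD-BC {A} {B} {C} {D} {m} {+ K} {P} {Q} om C*S₂≡ D*S₄≡)
      where
      open ≡-Reasoning
      P Q : ℤ
      P = proj₁ S₂-residue
      Q = proj₁ S₄-residue
      p≡q+2 : p ≡ q ℕ.+ 2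
      p≡q+2 = trans (sym (ℕ.+-identityʳ p))
                    (ν₂-lhs₂ ν₂M (subst (Val₂ 0) (sym (proj₂ S₂-residue)) (val₂-+ {j = 2} ν₂K (s≤s z≤n) P)))
      C*S₂≡ : C * (+ K + + 4 * P) ≡ A * m ^ 2
      C*S₂≡ = 2^-cancelˡ (q ℕ.+ 2) (begin
        2^ (q ℕ.+ 2) * (C * (+ K + + 4 * P))   ≡⟨ cong (λ S → 2^ (q ℕ.+ 2) * (C * S)) (proj₂ S₂-residue) ⟨
        2^ (q ℕ.+ 2) * (C * S₂)               ≡⟨ subst (λ p → 2^ p * (C * S₂) ≡ 2^ q * (A * M ^ 2)) p≡q+2 E2 ⟩
        2^ q * (A * M ^ 2)                    ≡⟨ cong (λ M → 2^ q * (A * M ^ 2)) M≡2m ⟩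
        2^ q * (A * (2^ 1 * m) ^ 2)           ≡⟨ solve 3 (λ t A m → t :* (A :* (con (+ 2) :* m) :^ 2)
                                                                  := t :* con (+ 4) :* (A :* m :^ 2))
                                                     refl (2^ q) A m ⟩
        2^ q * 2^ 2 * (A * m ^ 2)             ≡⟨ cong (_* (A * m ^ 2)) (ℤ.^-distribˡ-+-* (+ 2) q 2) ⟨
        2^ (q ℕ.+ 2) * (A * m ^ 2)            ∎)
      D*S₄≡ : D * (+ K + + 16 * Q) ≡ B * m ^ 4
      D*S₄≡ = 2^-cancelˡ 4 (begin
        2^ 4 * (D * (+ K + + 16 * Q))   ≡⟨ cong (λ S → 2^ 4 * (D * S)) (proj₂ S₄-residue) ⟨
        2^ 4 * (D * S₄)                ≡⟨ subst (λ b → 2^ b * (D * S₄) ≡ B * M ^ 4) b≡4 E4 ⟩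
        B * M ^ 4                      ≡⟨ cong (λ M → B * M ^ 4) M≡2m ⟩
        B * (2^ 1 * m) ^ 4             ≡⟨ solve 2 (λ B m → B :* (con (+ 2) :* m) :^ 4
                                                           := con (+ 16) :* (B :* m :^ 4))
                                             refl B m ⟩
        2^ 4 * (B * m ^ 4)             ∎)

    case-ν₂K≡1 : Val₂ 1 (+ K) → b ≡ 3 → Val₂ 1 M → PossibleExponents A B C D α (+ b)
    case-ν₂K≡1 ν₂K b≡3 ν₂M = one-three (posPart≡negPart+⇒ α p≡q+1) (cong +_ b≡3)
      where
      ν₂S₂ : Val₂ 1 S₂
      ν₂S₂ = subst (Val₂ 1) (sym (proj₂ S₂-residue)) (val₂-+ {j = 2} ν₂K (s≤s (s≤s z≤n)) (proj₁ S₂-residue))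
      p≡q+1 : p ≡ q ℕ.+ 1
      p≡q+1 = ℕ.+-cancelʳ-≡ 1 p (q ℕ.+ 1) (trans (ν₂-lhs₂ ν₂M ν₂S₂) (sym (ℕ.+-assoc q 1 1)))

    case-ν₂K≥2 : ∀ k → Val₂ (2 ℕ.+ k) (+ K) → b ≤ 2 → Val₂ 1 M → PossibleExponents A B C D α (+ b)
    case-ν₂K≥2 k (val₂ u ou K≡) b≤2 ν₂M = nonpositive (posPart≤negPart⇒ α p≤q) (ℤ.+≤+ b≤2)
      where
      open ≡-Reasoning
      P W : ℤ
      P = proj₁ S₂-residue
      W = 2^ k * u + P
      lhs≡ : 2^ p * (C * S₂) ≡ 2^ (p ℕ.+ 2) * (C * W)
      lhs≡ = begin
        2^ p * (C * S₂)                        ≡⟨ cong (λ S → 2^ p * (C * S)) (proj₂ S₂-residue) ⟩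
        2^ p * (C * (+ K + + 4 * P))           ≡⟨ cong (λ K → 2^ p * (C * (K + + 4 * P))) K≡ ⟩
        2^ p * (C * (2^ (2 ℕ.+ k) * u + + 4 * P))
          ≡⟨ solve 5 (λ t C s u P → t :* (C :* (con (+ 2) :* (con (+ 2) :* s) :* u :+ con (+ 4) :* P))
                                    := t :* con (+ 4) :* (C :* (s :* u :+ P))) refl (2^ p) C (2^ k) u P ⟩
        2^ p * 2^ 2 * (C * W)                  ≡⟨ cong (_* (C * W)) (ℤ.^-distribˡ-+-* (+ 2) p 2) ⟨
        2^ (p ℕ.+ 2) * (C * W)                 ∎
      p≤q : p ≤ q
      p≤q = ℕ.+-cancelʳ-≤ 2 p q (val₂-≤ (p ℕ.+ 2) (subst (Val₂ (q ℕ.+ 2)) (trans (sym E2) lhs≡) (ν₂-rhs₂ ν₂M)))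

    exponents-from-ν₂K : ∀ k → Val₂ k (+ K) → b ℕ.+ k ≡ 4 → Val₂ 1 M → PossibleExponents A B C D α (+ b)
    exponents-from-ν₂K zero          ν₂K b+0≡4 = case-ν₂K≡0 ν₂K (trans (sym (ℕ.+-identityʳ b)) b+0≡4)
    exponents-from-ν₂K (suc zero)    ν₂K b+1≡4 = case-ν₂K≡1 ν₂K (ℕ.+-cancelʳ-≡ 1 b 3 b+1≡4)
    exponents-from-ν₂K (suc (suc k)) ν₂K b+k+2≡4 =
      case-ν₂K≥2 k ν₂K (ℕ.+-cancelʳ-≤ 2 b 2 (ℕ.≤-trans (ℕ.+-monoʳ-≤ b (s≤s (s≤s z≤n))) (ℕ.≤-reflexive b+k+2≡4)))

    possible-exponents : ∀ {e} → Val₂ e M → (e ≡ 0 ⊎ ∃ λ i → Odd (a i)) → PossibleExponents A B C D α (+ b)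
    possible-exponents ν₂M (inj₁ refl) = ⊥-elim (odd-denominator-impossible ν₂M)
    possible-exponents {e} ν₂M (inj₂ (i , odd-aᵢ)) with ν₂-oddCount (oddCount-pos a i odd-aᵢ)
    ... | k , k<4 , ν₂K with ν₂-lhs₄ ν₂M (ν₂-S₄ k<4 ν₂K)
    ...   | b+k≡4e with ≡4*e⇒e≡1 {e = e} 1≤b b≤4 k<4 b+k≡4e
    ...     | refl = exponents-from-ν₂K k ν₂K b+k≡4e ν₂M

open ExponentBounds

open import Data.Integer using (_-_; _≤_)
open import Data.Integer.GCD using (gcd)
open import Data.Rational using (ℚ; _*_)

Conditions : ℤ → ℤ → ℤ → ℤ → ℤ → ℤ → Set
Conditions α β A B C D =
  (α ≤ + 0 × (β ≡ + 3 ⊎ β ≡ + 4))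
  ⊎ ((α ≡ + 1 × (β ≡ + 1 ⊎ β ≡ + 2 ⊎ β ≡ + 4)) ⊎ (α ≡ + 2 × (β ≡ + 1 ⊎ β ≡ + 2 ⊎ β ≡ + 3)))
  ⊎ (α ≡ + 2 × β ≡ + 4 × ¬ (+ 4 ∣ (A ℤ.* D - B ℤ.* C)))

conditions-excluded : ∀ {A B C D α β} → PossibleExponents A B C D α β → ¬ Conditions α β A B C D
conditions-excluded (two-four refl refl _)   (inj₁ (ℤ.+≤+ () , _))
conditions-excluded (two-four refl refl _)   (inj₂ (inj₁ (inj₁ (() , _))))
conditions-excluded (two-four refl refl _)   (inj₂ (inj₁ (inj₂ (_ , inj₁ ()))))
conditions-excluded (two-four refl refl _)   (inj₂ (inj₁ (inj₂ (_ , inj₂ (inj₁ ())))))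
conditions-excluded (two-four refl refl _)   (inj₂ (inj₁ (inj₂ (_ , inj₂ (inj₂ ())))))
conditions-excluded (two-four refl refl 4∣) (inj₂ (inj₂ (_ , _ , 4∤))) = 4∤ 4∣
conditions-excluded (one-three refl refl)    (inj₁ (ℤ.+≤+ () , _))
conditions-excluded (one-three refl refl)    (inj₂ (inj₁ (inj₁ (_ , inj₁ ()))))
conditions-excluded (one-three refl refl)    (inj₂ (inj₁ (inj₁ (_ , inj₂ (inj₁ ())))))
conditions-excluded (one-three refl refl)    (inj₂ (inj₁ (inj₁ (_ , inj₂ (inj₂ ())))))
conditions-excluded (one-three refl refl)    (inj₂ (inj₁ (inj₂ (() , _))))
conditions-excluded (one-three refl refl)    (inj₂ (inj₂ (() , _)))
conditions-excluded (nonpositive _ β≤2) (inj₁ (_ , inj₁ refl))           = ℤ.<⇒≱ (ℤ.+<+ (ℕ.s<s (ℕ.s<s ℕ.z<s))) β≤2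
conditions-excluded (nonpositive _ β≤2) (inj₁ (_ , inj₂ refl))           = ℤ.<⇒≱ (ℤ.+<+ (ℕ.s<s (ℕ.s<s ℕ.z<s))) β≤2
conditions-excluded (nonpositive α≤0 _) (inj₂ (inj₁ (inj₁ (refl , _)))) = ℤ.<⇒≱ (ℤ.+<+ ℕ.z<s) α≤0
conditions-excluded (nonpositive α≤0 _) (inj₂ (inj₁ (inj₂ (refl , _)))) = ℤ.<⇒≱ (ℤ.+<+ ℕ.z<s) α≤0
conditions-excluded (nonpositive α≤0 _) (inj₂ (inj₂ (refl , _)))         = ℤ.<⇒≱ (ℤ.+<+ ℕ.z<s) α≤0

lemma6p9 : (α β A B C D : ℤ) → α ≤ + 2 → + 1 ≤ β → β ≤ + 4
    → Odd A → Odd B → Odd C → Odd D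
    → gcd A C ≡ + 1 → gcd B D ≡ + 1
    → (N : ℕ) → 1 ℕ.≤ N → N ℕ.≤ 15
    → ((α ≤ + 0 × (β ≡ + 3 ⊎ β ≡ + 4))
       ⊎ ((α ≡ + 1 × (β ≡ + 1 ⊎ β ≡ + 2 ⊎ β ≡ + 4)) ⊎ (α ≡ + 2 × (β ≡ + 1 ⊎ β ≡ + 2 ⊎ β ≡ + 3)))
       ⊎ (α ≡ + 2 × β ≡ + 4 × ¬ (+ 4 ∣ (A ℤ.* D - B ℤ.* C))))
    → ¬ (∃ λ (x : Fin N → ℚ) →
           (sumℚ (λ i → x i ^ℚ 2) * (two^ α * ι C) ≡ ι A)
           × (sumℚ (λ i → x i ^ℚ 4) * (two^ β * ι D) ≡ ι B))
lemma6p9 α (+ b) A B C D _ (ℤ.+≤+ 1≤b) (ℤ.+≤+ b≤4) oA oB oC oD _ _ N _ N≤15 conditions (x , sum² , sum⁴) =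
  conditions-excluded (possible-exponents ν₂M reduced) conditions
  where
  open ReducedFractions (reduceFractions x)
  open ClearedEquations a M A B C D α oA oB oC oD 1≤b b≤4 N≤15
    (cross-multiply C A (power-sum-fraction x≐a/M 2) (two^-fraction α) sum²)
    (trans (cross-multiply D B (power-sum-fraction x≐a/M 4) (two^-fraction (+ b)) sum⁴) (ℤ.*-identityˡ _))
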